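{- Let $n\ge 6$ and let $\mathcal F\subset\binom{[n]}{3}$ be an almost intersecting family with $\{1,2,3\},\{4,5,6\}\in\mathcal F$. For $1\le a\le 3$, $4\le b\le 6$ define $D(a,b)=\{c\in[7,n]:\{a,b,c\}\in\mathcal F\}$. Let $(a_1,a_2,a_3)$ and $(b_1,b_2,b_3)$ be permutations of $(1,2,3)$ and $(4,5,6)$, respectively. Then: (i) if $D(a_i,b_i)\neq\emptyset$ for $i=1,2,3$, then $D(a_1,b_1)=D(a_2,b_2)=D(a_3,b_3)$ and this common set has exactly one element; (ii) if $|D(a_1,b_1)|\ge 3$, then $D(a_2,b_2)=D(a_3,b_3)=\emptyset$.
   Context: $[7,n]=\{7,\dots,n\}$ (empty if $n<7$). A family $\mathcal F$ is almost intersecting if it is not intersecting (some two members are disjoint) but each $F\in\mathcal F$ is disjoint from at most one member of $\mathcal F$. -}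

module Defs where

open import Data.Nat using (ℕ; suc; _≡ᵇ_; _≤_)
open import Data.Bool using (Bool)
open import Data.List using (List; []; _∷_)
open import Data.Bool.ListAction using (any)
open import Data.Fin using (Fin; toℕ)
open import Data.Fin.Subset using (Subset; _∩_; ∣_∣) renaming (⊥ to ∅)
open import Data.Vec using (tabulate)
open import Data.Product using (Σ; ∃; _×_; _,_)
open import Relation.Binary.PropositionalEquality using (_≡_)

-- Subsets of [n] = {1,…,n}: element i (1-based) ↔ index i-1 of Subset n.
-- The subset of [n] consisting of those elements of a list of naturals in [n].
⟦_⟧⟨_⟩ : List ℕ → (n : ℕ) → Subset n
⟦ xs ⟧⟨ n ⟩ = tabulate (λ (j : Fin n) → any (λ x → suc (toℕ j) ≡ᵇ x) xs)

triple : (n a b c : ℕ) → Subset n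
triple n a b c = ⟦ a ∷ b ∷ c ∷ [] ⟧⟨ n ⟩

Family : ℕ → Set₁
Family n = Subset n → Set

Disjoint : {n : ℕ} → Subset n → Subset n → Set
Disjoint F G = F ∩ G ≡ ∅

ThreeUniform : {n : ℕ} → Family n → Set
ThreeUniform {n} ℱ = ∀ F → ℱ F → ∣ F ∣ ≡ 3

NotIntersecting : {n : ℕ} → Family n → Set
NotIntersecting {n} ℱ = Σ (Subset n) λ F → Σ (Subset n) λ G → ℱ F × ℱ G × Disjoint F G

AtMostOneDisjoint : {n : ℕ} → Family n → Set
AtMostOneDisjoint {n} ℱ = ∀ F G H → ℱ F → ℱ G → ℱ H → Disjoint F G → Disjoint F H → G ≡ H

AlmostIntersecting : {n : ℕ} → Family n → Set
AlmostIntersecting ℱ = NotIntersecting ℱ × AtMostOneDisjoint ℱ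

-- c ∈ D(a,b) = { c ∈ [7,n] : {a,b,c} ∈ ℱ }
D : {n : ℕ} → Family n → ℕ → ℕ → ℕ → Set
D {n} ℱ a b c = 7 ≤ c × c ≤ n × ℱ (triple n a b c)

-- For 1 ≤ a ≤ 3 < b ≤ 6 < c, the triples {a,b,c} and {a',b',c'} are disjoint as soon as they
-- differ in every coordinate, and distinct as soon as they differ in one.  So if {a,b,c} ∈ ℱ
-- differs in every coordinate from two members of ℱ, almost-intersection forces those two to
-- coincide.  (i) If c₁ ≠ c₂ and c₁ ≠ c₃, then {a₁,b₁,c₁} would be disjoint from the distinct
-- members {a₂,b₂,c₂} and {a₃,b₃,c₃}; if c₁ = c₃ ≠ c₂, the same happens to {a₂,b₂,c₂}.
-- (ii) Any c ∈ D(a₂,b₂) differs from two of three distinct elements of D(a₁,b₁).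
module Submission where

open import Defs
open import Data.Nat using (ℕ; suc; _≤_; _<_; s≤s; z≤n)
open import Data.Nat.Properties using (_≟_; ≤-trans; ≤-<-trans; ≤⇒≯; ≤-refl; ≡⇒≡ᵇ; ≡ᵇ⇒≡)
open import Data.Bool.Properties using (T-≡)
open import Data.Fin using (Fin; toℕ; fromℕ<)
open import Data.Fin.Properties using (toℕ-fromℕ<)
open import Data.Fin.Subset using () renaming (_∈_ to _∈ₛ_)
open import Data.Fin.Subset.Properties using (Empty-unique; x∈p∩q⁻)
open import Data.Vec.Properties using (lookup∘tabulate; []=⇒lookup; lookup⇒[]=)
open import Data.List using ([]; _∷_)
open import Data.List.Membership.Propositional using (_∈_; _∉_)
open import Data.List.Relation.Unary.Any as Any using (here; there)
open import Data.List.Relation.Unary.Any.Properties using (any⁺; any⁻)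
open import Data.List.Relation.Unary.All using ([]; _∷_)
open import Data.List.Relation.Unary.Unique.Propositional using (Unique; []; _∷_)
open import Data.List.Relation.Binary.Permutation.Propositional using (_↭_; ↭-sym; ↭⇒↭ₛ)
open import Data.List.Relation.Binary.Permutation.Propositional.Properties using (∈-resp-↭)
open import Data.List.Relation.Binary.Permutation.Setoid.Properties using (Unique-resp-↭)
open import Data.Product using (Σ; ∃; _×_; _,_; proj₁; proj₂)
open import Data.Empty using (⊥; ⊥-elim)
open import Function using (_∘_)
open import Function.Bundles using (_⇔_; mk⇔; Equivalence)
open import Relation.Binary.PropositionalEquality using (_≡_; _≢_; refl; sym; trans; cong; subst; setoid)
open import Relation.Nullary using (¬_; yes; no)

∈⟦⟧⁺ : ∀ {n xs} (i : Fin n) → suc (toℕ i) ∈ xs → i ∈ₛ ⟦ xs ⟧⟨ n ⟩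
∈⟦⟧⁺ i k∈xs = lookup⇒[]= i _
  (trans (lookup∘tabulate _ i) (Equivalence.to T-≡ (any⁺ _ (Any.map (≡⇒≡ᵇ _ _) k∈xs))))

∈⟦⟧⁻ : ∀ {n xs} (i : Fin n) → i ∈ₛ ⟦ xs ⟧⟨ n ⟩ → suc (toℕ i) ∈ xs
∈⟦⟧⁻ {xs = xs} i i∈ = Any.map (≡ᵇ⇒≡ _ _)
  (any⁻ _ xs (Equivalence.from T-≡ (trans (sym (lookup∘tabulate _ i)) ([]=⇒lookup i∈))))

⟦⟧-disjoint : ∀ {n xs ys} → (∀ {k} → k ∈ xs → k ∉ ys) → Disjoint ⟦ xs ⟧⟨ n ⟩ ⟦ ys ⟧⟨ n ⟩
⟦⟧-disjoint separated = Empty-unique λ (i , i∈∩) →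
  let i∈xs , i∈ys = x∈p∩q⁻ _ _ i∈∩ in separated (∈⟦⟧⁻ i i∈xs) (∈⟦⟧⁻ i i∈ys)

⟦⟧-≡⇒∈ : ∀ {n xs ys k} → 1 ≤ k → k ≤ n → ⟦ xs ⟧⟨ n ⟩ ≡ ⟦ ys ⟧⟨ n ⟩ → k ∈ xs → k ∈ ys
⟦⟧-≡⇒∈ {n} {xs} {ys} {suc m} _ m<n eq k∈xs =
  subst (_∈ ys) index-ok (∈⟦⟧⁻ i (subst (i ∈ₛ_) eq (∈⟦⟧⁺ i (subst (_∈ xs) (sym index-ok) k∈xs))))
  where
  i : Fin n
  i = fromℕ< m<n
  index-ok : suc (toℕ i) ≡ suc m
  index-ok = cong suc (toℕ-fromℕ< m<n)

record Layered (a b c : ℕ) : Set where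
  constructor layered
  field
    1≤a : 1 ≤ a
    a≤3 : a ≤ 3
    3<b : 3 < b
    b≤6 : b ≤ 6
    6<c : 6 < c

open Layered

3≤6 : 3 ≤ 6
3≤6 = s≤s (s≤s (s≤s z≤n))

module _ {a b c k : ℕ} (L : Layered a b c) where

  low-slot : k ≤ 3 → k ∈ a ∷ b ∷ c ∷ [] → k ≡ a
  low-slot k≤3 (here k≡a)                 = k≡a
  low-slot k≤3 (there (here refl))        = ⊥-elim (≤⇒≯ k≤3 (3<b L))
  low-slot k≤3 (there (there (here refl))) = ⊥-elim (≤⇒≯ k≤3 (≤-<-trans 3≤6 (6<c L)))

  mid-slot : 3 < k → k ≤ 6 → k ∈ a ∷ b ∷ c ∷ [] → k ≡ b
  mid-slot 3<k k≤6 (here refl)                 = ⊥-elim (≤⇒≯ (a≤3 L) 3<k)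
  mid-slot 3<k k≤6 (there (here k≡b))          = k≡b
  mid-slot 3<k k≤6 (there (there (here refl))) = ⊥-elim (≤⇒≯ k≤6 (6<c L))

  high-slot : 6 < k → k ∈ a ∷ b ∷ c ∷ [] → k ≡ c
  high-slot 6<k (here refl)                 = ⊥-elim (≤⇒≯ (≤-trans (a≤3 L) 3≤6) 6<k)
  high-slot 6<k (there (here refl))         = ⊥-elim (≤⇒≯ (b≤6 L) 6<k)
  high-slot 6<k (there (there (here k≡c)))  = k≡c

Opposite : (a b a′ b′ : ℕ) → Set
Opposite a b a′ b′ = a ≢ a′ × b ≢ b′

opposite-sym : ∀ {a b a′ b′} → Opposite a b a′ b′ → Opposite a′ b′ a b
opposite-sym (a≢a′ , b≢b′) = a≢a′ ∘ sym , b≢b′ ∘ sym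

layered-disjoint : ∀ {n a b c a′ b′ c′} → Layered a b c → Layered a′ b′ c′
  → Opposite a b a′ b′ → c ≢ c′ → Disjoint (triple n a b c) (triple n a′ b′ c′)
layered-disjoint {a = a} {b} {c} {a′} {b′} {c′} L L′ (a≢a′ , b≢b′) c≢c′ = ⟦⟧-disjoint separated
  where
  separated : ∀ {k} → k ∈ a ∷ b ∷ c ∷ [] → k ∉ a′ ∷ b′ ∷ c′ ∷ []
  separated (here refl)                 k∈ = a≢a′ (low-slot L′ (a≤3 L) k∈)
  separated (there (here refl))         k∈ = b≢b′ (mid-slot L′ (3<b L) (b≤6 L) k∈)
  separated (there (there (here refl))) k∈ = c≢c′ (high-slot L′ (6<c L) k∈)

layered-injective : ∀ {n a b c a′ b′ c′} → 6 ≤ n → c ≤ n → Layered a b c → Layered a′ b′ c′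
  → triple n a b c ≡ triple n a′ b′ c′ → a ≡ a′ × b ≡ b′ × c ≡ c′
layered-injective {n} {a} {b} {c} {a′} {b′} {c′} 6≤n c≤n L L′ eq =
  low-slot L′ (a≤3 L) (carry (1≤a L) (≤-trans (a≤3 L) (≤-trans 3≤6 6≤n)) (here refl)) ,
  mid-slot L′ (3<b L) (b≤6 L) (carry (positive (3<b L)) (≤-trans (b≤6 L) 6≤n) (there (here refl))) ,
  high-slot L′ (6<c L) (carry (positive (6<c L)) c≤n (there (there (here refl))))
  where
  positive : ∀ {m k} → m < k → 1 ≤ k
  positive = ≤-trans (s≤s z≤n)
  carry : ∀ {k} → 1 ≤ k → k ≤ n → k ∈ a ∷ b ∷ c ∷ [] → k ∈ a′ ∷ b′ ∷ c′ ∷ []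
  carry 1≤k k≤n = ⟦⟧-≡⇒∈ 1≤k k≤n eq

low-bounds : ∀ {a} → a ∈ 1 ∷ 2 ∷ 3 ∷ [] → 1 ≤ a × a ≤ 3
low-bounds (here refl)                 = s≤s z≤n , s≤s z≤n
low-bounds (there (here refl))         = s≤s z≤n , s≤s (s≤s z≤n)
low-bounds (there (there (here refl))) = s≤s z≤n , s≤s (s≤s (s≤s z≤n))

mid-bounds : ∀ {b} → b ∈ 4 ∷ 5 ∷ 6 ∷ [] → 3 < b × b ≤ 6
mid-bounds (here refl)                 = ≤-refl , s≤s (s≤s (s≤s (s≤s z≤n)))
mid-bounds (there (here refl))         = s≤s (s≤s (s≤s (s≤s z≤n))) , s≤s (s≤s (s≤s (s≤s (s≤s z≤n))))
mid-bounds (there (there (here refl))) = s≤s (s≤s (s≤s (s≤s z≤n))) , ≤-refl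

module Points {n : ℕ} (6≤n : 6 ≤ n) {ℱ : Family n} (one-disjoint : AtMostOneDisjoint ℱ) where

  Point : (a b c : ℕ) → Set
  Point a b c = Layered a b c × c ≤ n × ℱ (triple n a b c)

  D⇒Point : ∀ {a b c} → a ∈ 1 ∷ 2 ∷ 3 ∷ [] → b ∈ 4 ∷ 5 ∷ 6 ∷ [] → D ℱ a b c → Point a b c
  D⇒Point a∈ b∈ (7≤c , c≤n , F) =
    let 1≤a , a≤3 = low-bounds a∈ ; 3<b , b≤6 = mid-bounds b∈ in
    layered 1≤a a≤3 3<b b≤6 7≤c , c≤n , F

  opposite-partner-unique : ∀ {a b c a′ b′ c′ a″ b″ c″}
    → Point a b c → Point a′ b′ c′ → Point a″ b″ c″
    → Opposite a b a′ b′ → Opposite a b a″ b″ → c ≢ c′ → c ≢ c″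
    → a′ ≡ a″ × b′ ≡ b″ × c′ ≡ c″
  opposite-partner-unique (L , _ , F) (L′ , c′≤n , G) (L″ , _ , H) o′ o″ c≢c′ c≢c″ =
    layered-injective 6≤n c′≤n L′ L″
      (one-disjoint _ _ _ F G H (layered-disjoint L L′ o′ c≢c′) (layered-disjoint L L″ o″ c≢c″))

  apices-agree : ∀ {a b c a′ b′ c′ a″ b″ c″}
    → Point a b c → Point a′ b′ c′ → Point a″ b″ c″
    → Opposite a b a′ b′ → Opposite a b a″ b″ → Opposite a′ b′ a″ b″ → c ≡ c′
  apices-agree {c = c} {c′ = c′} {c″ = c″} P P′ P″ o′ o″ o‴ with c ≟ c′ | c ≟ c″
  ... | yes c≡c′ | _ = c≡c′
  ... | no c≢c′ | no c≢c″ =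
    ⊥-elim (proj₁ o‴ (proj₁ (opposite-partner-unique P P′ P″ o′ o″ c≢c′ c≢c″)))
  ... | no c≢c′ | yes c≡c″ =
    ⊥-elim (proj₁ o″ (proj₁ (opposite-partner-unique P′ P P″ (opposite-sym o′) o‴
      (c≢c′ ∘ sym) (λ c′≡c″ → c≢c′ (trans c≡c″ (sym c′≡c″))))))

  ¬opposite-to-two-apices : ∀ {a b x y a′ b′ c}
    → Point a b x → Point a b y → x ≢ y
    → Opposite a′ b′ a b → Point a′ b′ c → c ≢ x → c ≢ y → ⊥
  ¬opposite-to-two-apices Pₓ Pᵧ x≢y o P c≢x c≢y =
    x≢y (proj₂ (proj₂ (opposite-partner-unique P Pₓ Pᵧ o o c≢x c≢y)))

  three-apices-exclude-opposite : ∀ {a b c₁ c₂ c₃ a′ b′ c}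
    → Point a b c₁ → Point a b c₂ → Point a b c₃ → c₁ ≢ c₂ → c₁ ≢ c₃ → c₂ ≢ c₃
    → Opposite a′ b′ a b → ¬ Point a′ b′ c
  three-apices-exclude-opposite {c₁ = c₁} {c₂} {c = c} P₁ P₂ P₃ c₁≢c₂ c₁≢c₃ c₂≢c₃ o P
    with c ≟ c₁ | c ≟ c₂
  ... | yes refl | _        = ¬opposite-to-two-apices P₂ P₃ c₂≢c₃ o P c₁≢c₂ c₁≢c₃
  ... | no c≢c₁  | yes refl = ¬opposite-to-two-apices P₁ P₃ c₁≢c₃ o P c≢c₁ c₂≢c₃
  ... | no c≢c₁  | no c≢c₂  = ¬opposite-to-two-apices P₁ P₂ c₁≢c₂ o P c≢c₁ c≢c₂

unique-witness⇒⇔≡ : ∀ {P : ℕ → Set} {c x} → P x → (∀ d → P d → d ≡ c) → ∀ d → P d ⇔ d ≡ c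
unique-witness⇒⇔≡ {P} {c} {x} Px unique d =
  mk⇔ (unique d) (λ d≡c → subst P (trans (unique x Px) (sym d≡c)) Px)

pairwise-distinct₃ : ∀ {x y z : ℕ} → Unique (x ∷ y ∷ z ∷ []) → x ≢ y × x ≢ z × y ≢ z
pairwise-distinct₃ ((x≢y ∷ x≢z ∷ []) ∷ (y≢z ∷ []) ∷ [] ∷ []) = x≢y , x≢z , y≢z

↭⇒pairwise-distinct₃ : ∀ {x y z u v w : ℕ} → x ∷ y ∷ z ∷ [] ↭ u ∷ v ∷ w ∷ []
  → Unique (u ∷ v ∷ w ∷ []) → x ≢ y × x ≢ z × y ≢ z
↭⇒pairwise-distinct₃ p = pairwise-distinct₃ ∘ Unique-resp-↭ (setoid ℕ) (↭⇒↭ₛ (↭-sym p))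

lemma4p1 : (n : ℕ) → 6 ≤ n → (ℱ : Family n) → ThreeUniform ℱ → AlmostIntersecting ℱ
    → ℱ (triple n 1 2 3) → ℱ (triple n 4 5 6)
    → (a₁ a₂ a₃ b₁ b₂ b₃ : ℕ)
    → (a₁ ∷ a₂ ∷ a₃ ∷ []) ↭ (1 ∷ 2 ∷ 3 ∷ [])
    → (b₁ ∷ b₂ ∷ b₃ ∷ []) ↭ (4 ∷ 5 ∷ 6 ∷ [])
    → (∃ (D ℱ a₁ b₁) → ∃ (D ℱ a₂ b₂) → ∃ (D ℱ a₃ b₃)
        → Σ ℕ λ c → (∀ d → D ℱ a₁ b₁ d ⇔ (d ≡ c))
                  × (∀ d → D ℱ a₂ b₂ d ⇔ (d ≡ c))
                  × (∀ d → D ℱ a₃ b₃ d ⇔ (d ≡ c)))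
    × ((c₁ c₂ c₃ : ℕ) → c₁ ≢ c₂ → c₁ ≢ c₃ → c₂ ≢ c₃
        → D ℱ a₁ b₁ c₁ → D ℱ a₁ b₁ c₂ → D ℱ a₁ b₁ c₃
        → ∀ c → ¬ D ℱ a₂ b₂ c × ¬ D ℱ a₃ b₃ c)
lemma4p1 n 6≤n ℱ _ (_ , one-disjoint) _ _ a₁ a₂ a₃ b₁ b₂ b₃ pa pb =
  (λ (c₁ , w₁) (c₂ , w₂) (c₃ , w₃) →
    let c₂≡c₁ = apices-agree (P₂ w₂) (P₁ w₁) (P₃ w₃) o₂₁ o₂₃ o₁₃ in
    c₁ , unique-witness⇒⇔≡ w₁ (λ d w → trans (apices-agree (P₁ w) (P₂ w₂) (P₃ w₃) o₁₂ o₁₃ o₂₃) c₂≡c₁)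
       , unique-witness⇒⇔≡ w₂ (λ d w → apices-agree (P₂ w) (P₁ w₁) (P₃ w₃) o₂₁ o₂₃ o₁₃)
       , unique-witness⇒⇔≡ w₃ (λ d w → apices-agree (P₃ w) (P₁ w₁) (P₂ w₂) o₃₁ o₃₂ o₁₂))
  , λ c₁ c₂ c₃ c₁≢c₂ c₁≢c₃ c₂≢c₃ w₁ w₂ w₃ c →
    let excluded : ∀ {a b c} → Opposite a b a₁ b₁ → ¬ Point a b c
        excluded = three-apices-exclude-opposite (P₁ w₁) (P₁ w₂) (P₁ w₃) c₁≢c₂ c₁≢c₃ c₂≢c₃
    in excluded o₂₁ ∘ P₂ , excluded o₃₁ ∘ P₃
  where
  open Points 6≤n one-disjoint
  P₁ : ∀ {c} → D ℱ a₁ b₁ c → Point a₁ b₁ c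
  P₁ = D⇒Point (∈-resp-↭ pa (here refl)) (∈-resp-↭ pb (here refl))
  P₂ : ∀ {c} → D ℱ a₂ b₂ c → Point a₂ b₂ c
  P₂ = D⇒Point (∈-resp-↭ pa (there (here refl))) (∈-resp-↭ pb (there (here refl)))
  P₃ : ∀ {c} → D ℱ a₃ b₃ c → Point a₃ b₃ c
  P₃ = D⇒Point (∈-resp-↭ pa (there (there (here refl)))) (∈-resp-↭ pb (there (there (here refl))))
  distinct-a : a₁ ≢ a₂ × a₁ ≢ a₃ × a₂ ≢ a₃
  distinct-a = ↭⇒pairwise-distinct₃ pa (((λ ()) ∷ (λ ()) ∷ []) ∷ ((λ ()) ∷ []) ∷ [] ∷ [])
  distinct-b : b₁ ≢ b₂ × b₁ ≢ b₃ × b₂ ≢ b₃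
  distinct-b = ↭⇒pairwise-distinct₃ pb (((λ ()) ∷ (λ ()) ∷ []) ∷ ((λ ()) ∷ []) ∷ [] ∷ [])
  o₁₂ : Opposite a₁ b₁ a₂ b₂
  o₁₂ = proj₁ distinct-a , proj₁ distinct-b
  o₁₃ : Opposite a₁ b₁ a₃ b₃
  o₁₃ = proj₁ (proj₂ distinct-a) , proj₁ (proj₂ distinct-b)
  o₂₃ : Opposite a₂ b₂ a₃ b₃
  o₂₃ = proj₂ (proj₂ distinct-a) , proj₂ (proj₂ distinct-b)
  o₂₁ : Opposite a₂ b₂ a₁ b₁
  o₂₁ = opposite-sym o₁₂
  o₃₁ : Opposite a₃ b₃ a₁ b₁
  o₃₁ = opposite-sym o₁₃
  o₃₂ : Opposite a₃ b₃ a₂ b₂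
  o₃₂ = opposite-sym o₂₃
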